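{- Let $g$ be a (loopless) convex geometry on a finite ground set $I$. The number of enriched extremal functions $f: I \rightarrow [\![ n ]\!]$ with respect to $g$ is a polynomial in $n$.
   Context: A convex geometry on $I$ is a closure operator $g:2^I\to 2^I$ with $g(\emptyset)=\emptyset$ satisfying the anti-exchange axiom; subsets $A$ with $g(A)=A$ are called convex, and for a convex set $K$, $\mathrm{Ex}(K)=\{a\in K\mid K\setminus a \text{ is convex}\}$ is its set of extreme points. For $n\in\mathbb{N}$, $[\![ n ]\!] = \{\overline{1},1,\overline{2},2,\dots,\overline{n},n\}$ with the linear order $\overline{1}<1<\overline{2}<2<\dots<\overline{n}<n$, where barred elements are regarded as negative. A function $f:I\to[\![ n ]\!]$ is enriched extremal with respect to $g$ (Billera–Hsiao–Provan) if (1) for every convex set $A$ there exists $a\in\mathrm{Ex}(A)$ with $f(a)=f_A:=\min\{f(a)\mid a\in A\}$, and (2) for $a\in I$, if $f(a)<0$ (i.e. $f(a)$ is barred), then $a\in\mathrm{Ex}(\{b\in I\mid f(b)\geq f(a)\})$. -}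

module Defs where

open import Data.Nat as ℕ using (ℕ; zero; suc; _*_; _≤_)
open import Data.Fin using (Fin; toℕ)
open import Data.Fin.Subset using (Subset; _∈_; _∉_; _⊆_; _∪_; _-_; ⁅_⁆; ⊥)
open import Data.Vec using (Vec; lookup; tabulate)
open import Data.List using (List; length; []; _∷_)
open import Data.List.Relation.Unary.Unique.Propositional using (Unique)
open import Data.List.Membership.Propositional using () renaming (_∈_ to _∈ₗ_)
open import Data.Product using (Σ; ∃; ∃-syntax; _×_; _,_)
open import Data.Integer using (+_)
open import Data.Rational as ℚ using (ℚ; _/_)
open import Function.Bundles using (_⇔_)
open import Relation.Binary.PropositionalEquality using (_≡_; _≢_)
open import Relation.Nullary using (¬_; does)

record ConvexGeometry (m : ℕ) : Set where
  field
    g          : Subset m → Subset m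
    extensive  : ∀ A → A ⊆ g A
    monotone   : ∀ A B → A ⊆ B → g A ⊆ g B
    idempotent : ∀ A → g (g A) ≡ g A
    -- loopless: g(∅) = ∅
    g-empty    : g ⊥ ≡ ⊥
    antiExchange : ∀ A x y → g A ≡ A → x ≢ y → x ∉ A → y ∉ A →
                   y ∈ g (A ∪ ⁅ x ⁆) → x ∉ g (A ∪ ⁅ y ⁆)

module _ {m : ℕ} (G : ConvexGeometry m) where
  open ConvexGeometry G

  IsConvex : Subset m → Set
  IsConvex A = g A ≡ A

  _∈Ex_ : Fin m → Subset m → Set
  a ∈Ex K = a ∈ K × IsConvex (K - a)

-- The chain [[n]] = {1̄ < 1 < 2̄ < 2 < ... < n̄ < n}.
-- The element (k , bar) is the barred (negative) k+1 with k : Fin n,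
-- (k , pos) is the unbarred k+1.

data Sign : Set where
  bar pos : Sign

Label : ℕ → Set
Label n = Fin n × Sign

code : ∀ {n} → Label n → ℕ
code (k , bar) = 2 * toℕ k
code (k , pos) = suc (2 * toℕ k)

_≤L_ : ∀ {n} → Label n → Label n → Set
x ≤L y = code x ≤ code y

Barred : ∀ {n} → Label n → Set
Barred (_ , s) = s ≡ bar

-- functions f : I → [[n]] are represented as vectors (f a = lookup f a)
module _ {m : ℕ} (G : ConvexGeometry m) where
  open ConvexGeometry G

  upSet : ∀ {n} → Vec (Label n) m → Fin m → Subset m
  upSet f a = tabulate (λ b → does (code (lookup f a) ℕ.≤? code (lookup f b)))

  record EnrichedExtremal {n : ℕ} (f : Vec (Label n) m) : Set where
    field
      cond1 : ∀ A → IsConvex G A → (∃[ b ] b ∈ A) →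
              ∃[ a ] (_∈Ex_ G a A × (∀ b → b ∈ A → lookup f a ≤L lookup f b))
      cond2 : ∀ a → Barred (lookup f a) → _∈Ex_ G a (upSet f a)

HasCount : {A : Set} → (A → Set) → ℕ → Set
HasCount {A} P c = ∃[ L ] (Unique L × (∀ (x : A) → (x ∈ₗ L) ⇔ P x) × length L ≡ c)

ℕtoℚ : ℕ → ℚ
ℕtoℚ k = (+ k) / 1

-- polynomial with rational coefficients c₀ ∷ c₁ ∷ ... (Horner evaluation)
evalPoly : List ℚ → ℚ → ℚ
evalPoly []       x = ℚ.0ℚ
evalPoly (c ∷ cs) x = c ℚ.+ x ℚ.* evalPoly cs x

-- Whether f is enriched extremal depends only on its pattern: the preorder
-- a ≼ b ⇔ f a ≤ f b on I together with the set of barred values.  Relabelling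
-- the levels {ī, i} of [[n]] by an order embedding therefore preserves it, so
-- grouping functions by the set of levels they hit gives the count
-- Σₖ eₖ · C(n, k), where eₖ counts the enriched extremal functions into [[k]]
-- that hit every level; eₖ = 0 for k > |I|, so this is a polynomial in n.
-- Rather than enumerating level sets, the formula is obtained from the
-- recurrence N(j, t+1) = N(j+1, t) + N(j, t) for the number N(j, t) of enriched
-- extremal functions into [[t + j]] hitting each of the first j levels: either
-- level j+1 is hit too, or it is unused and can be squeezed out.

module Submission where

open import Defs
open import Data.Bool.Properties using () renaming (_≟_ to _≟ᵇ_)
open import Data.Empty using (⊥; ⊥-elim)
open import Data.Fin as Fin using (Fin; toℕ; punchIn; punchOut)
import Data.Fin.Properties as FinP
open import Data.Fin.Subset using (Subset; _-_)
open import Data.Fin.Subset.Properties using (_∈?_; anySubset?)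
import Data.Integer as ℤ
import Data.Integer.Properties as ℤP
open import Data.List as List
  using (List; []; _∷_; _++_; filter; length; cartesianProduct; cartesianProductWith; allFin)
import Data.List.Properties as ListP
import Data.List.Membership.Propositional as List
open import Data.List.Membership.Propositional.Properties
  using ( ∈-filter⁻; ∈-filter⁺; ∈-++⁻; ∈-++⁺ˡ; ∈-++⁺ʳ; ∈-map⁺; ∈-map⁻
        ; ∈-cartesianProductWith⁺; ∈-cartesianProduct⁺; ∈-allFin)
open import Data.List.Relation.Unary.All using ([]; _∷_)
open import Data.List.Relation.Unary.AllPairs using ([]; _∷_)
open import Data.List.Relation.Unary.Any using (here; there)
open import Data.List.Relation.Unary.Unique.Propositional using (Unique)
import Data.List.Relation.Unary.Unique.Propositional.Properties as UniqueP
open import Data.Nat as ℕ using (ℕ; zero; suc; _+_; _*_; _≤_; _<_; s≤s)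
import Data.Nat.Properties as ℕP
open import Data.Nat.Combinatorics using (_C_; nC1≡n; nCk+nC[k+1]≡[n+1]C[k+1])
open import Data.Nat.Coprimality using (1-coprimeTo) renaming (sym to coprime-sym)
open import Data.Nat.Tactic.RingSolver using (solve-∀)
open import Data.Product using (∃-syntax; _×_; _,_; proj₁; proj₂; map₁)
open import Data.Rational as ℚ using (ℚ; mkℚ; 0ℚ; 1ℚ; 1/_)
import Data.Rational.Properties as ℚP
open import Data.Rational.Solver using (module +-*-Solver)
open import Data.Sum using ([_,_]′)
open import Data.Vec as Vec using (Vec; []; _∷_; lookup; tabulate)
import Data.Vec.Properties as VecP
open import Data.Vec.Relation.Binary.Pointwise.Extensional using (ext; Pointwise-≡⇒≡)
open import Function using (_∘_)
open import Function.Bundles using (_⇔_; mk⇔; Equivalence)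
open import Function.Construct.Composition using (_⇔-∘_)
open import Function.Construct.Symmetry using (⇔-sym)
open import Relation.Binary.PropositionalEquality
open import Relation.Nullary using (¬_; Dec; yes; no)
open import Relation.Nullary.Decidable using (map′; _×-dec_; _→-dec_; decidable-stable; ¬?; does-⇔)
open import Relation.Unary using (Decidable)

fromℕ : ℕ → ℚ
fromℕ k = mkℚ (ℤ.+ k) 0 (coprime-sym (1-coprimeTo k))

ℕtoℚ≡fromℕ : ∀ k → ℕtoℚ k ≡ fromℕ k
ℕtoℚ≡fromℕ k = ℚP.normalize-coprime (coprime-sym (1-coprimeTo k))

ℕtoℚ-+ : ∀ a b → ℕtoℚ (a + b) ≡ ℕtoℚ a ℚ.+ ℕtoℚ b
ℕtoℚ-+ a b rewrite ℕtoℚ≡fromℕ a | ℕtoℚ≡fromℕ b =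
  cong (ℚ._/ 1) (cong₂ ℤ._+_ (sym (ℤP.*-identityʳ (ℤ.+ a))) (sym (ℤP.*-identityʳ (ℤ.+ b))))

ℕtoℚ-* : ∀ a b → ℕtoℚ (a * b) ≡ ℕtoℚ a ℚ.* ℕtoℚ b
ℕtoℚ-* a b rewrite ℕtoℚ≡fromℕ a | ℕtoℚ≡fromℕ b = cong (ℚ._/ 1) (ℤP.pos-* a b)

-- 1/_ needs a NonZero instance, which Agda finds for fromℕ (suc k) but not for ℕtoℚ (suc k).
inv-suc : ℕ → ℚ
inv-suc k = 1/ fromℕ (suc k)

inv-suc-* : ∀ k → inv-suc k ℚ.* ℕtoℚ (suc k) ≡ 1ℚ
inv-suc-* k = trans (cong (inv-suc k ℚ.*_) (ℕtoℚ≡fromℕ (suc k))) (ℚP.*-inverseˡ (fromℕ (suc k)))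

infixl 6 _⊕_
infixr 7 _⊙_

_⊕_ : List ℚ → List ℚ → List ℚ
[]      ⊕ q       = q
(a ∷ p) ⊕ []      = a ∷ p
(a ∷ p) ⊕ (b ∷ q) = a ℚ.+ b ∷ p ⊕ q

_⊙_ : ℚ → List ℚ → List ℚ
c ⊙ p = List.map (c ℚ.*_) p

module _ where
  open +-*-Solver

  evalPoly-⊕ : ∀ p q x → evalPoly (p ⊕ q) x ≡ evalPoly p x ℚ.+ evalPoly q x
  evalPoly-⊕ []      q       x = sym (ℚP.+-identityˡ _)
  evalPoly-⊕ (a ∷ p) []      x = sym (ℚP.+-identityʳ _)
  evalPoly-⊕ (a ∷ p) (b ∷ q) x rewrite evalPoly-⊕ p q x =
    solve 5 (λ a b x u v → (a :+ b) :+ x :* (u :+ v) := (a :+ x :* u) :+ (b :+ x :* v))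
      refl a b x (evalPoly p x) (evalPoly q x)

  evalPoly-⊙ : ∀ c p x → evalPoly (c ⊙ p) x ≡ c ℚ.* evalPoly p x
  evalPoly-⊙ c []      x = sym (ℚP.*-zeroʳ c)
  evalPoly-⊙ c (a ∷ p) x rewrite evalPoly-⊙ c p x =
    solve 4 (λ c a x u → c :* a :+ x :* (c :* u) := c :* (a :+ x :* u)) refl c a x (evalPoly p x)

absorption : ∀ n k → suc k * (n C suc k) + k * (n C k) ≡ n * (n C k)
absorption n       zero    = begin
  1 * (n C 1) + 0 ≡⟨ ℕP.+-identityʳ _ ⟩
  1 * (n C 1)     ≡⟨ ℕP.*-identityˡ _ ⟩
  n C 1           ≡⟨ nC1≡n n ⟩
  n               ≡⟨ ℕP.*-identityʳ n ⟨
  n * 1           ∎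
  where open ≡-Reasoning
absorption zero    (suc k) = cong₂ _+_ (ℕP.*-zeroʳ (suc (suc k))) (ℕP.*-zeroʳ (suc k))
absorption (suc n) (suc k) = begin
  (2 + k) * (suc n C (2 + k)) + (1 + k) * (suc n C (1 + k))
    ≡⟨ cong₂ (λ x y → (2 + k) * x + (1 + k) * y) (pascal (suc k)) (pascal k) ⟨
  (2 + k) * (b + c) + (1 + k) * (a + b)
    ≡⟨ regroup a b c k ⟩
  ((2 + k) * c + (1 + k) * b) + (b + a) + ((1 + k) * b + k * a)
    ≡⟨ cong₂ (λ x y → x + (b + a) + y) (absorption n (suc k)) (absorption n k) ⟩
  n * b + (b + a) + n * a
    ≡⟨ collect a b n ⟩
  (1 + n) * (a + b)
    ≡⟨ cong (suc n *_) (pascal k) ⟩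
  suc n * (suc n C suc k) ∎
  where
  open ≡-Reasoning
  pascal : ∀ i → n C i + n C suc i ≡ suc n C suc i
  pascal = nCk+nC[k+1]≡[n+1]C[k+1] n
  a b c : ℕ
  a = n C k
  b = n C suc k
  c = n C suc (suc k)
  regroup : ∀ a b c k → (2 + k) * (b + c) + (1 + k) * (a + b)
                      ≡ ((2 + k) * c + (1 + k) * b) + (b + a) + ((1 + k) * b + k * a)
  regroup = solve-∀
  collect : ∀ a b n → n * b + (b + a) + n * a ≡ (1 + n) * (a + b)
  collect = solve-∀

-- (k + 1) · C(x, k + 1) = (x − k) · C(x, k)
binomialPoly : ℕ → List ℚ
binomialPoly zero    = 1ℚ ∷ []
binomialPoly (suc k) = inv-suc k ⊙ ((0ℚ ∷ binomialPoly k) ⊕ ℚ.- ℕtoℚ k ⊙ binomialPoly k)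

evalPoly-binomialPoly : ∀ k n → evalPoly (binomialPoly k) (ℕtoℚ n) ≡ ℕtoℚ (n C k)
evalPoly-binomialPoly zero    n = trans (cong (1ℚ ℚ.+_) (ℚP.*-zeroʳ (ℕtoℚ n))) (ℚP.+-identityʳ 1ℚ)
evalPoly-binomialPoly (suc k) n = begin
  evalPoly (inv-suc k ⊙ ((0ℚ ∷ B) ⊕ ℚ.- K ⊙ B)) x
    ≡⟨ evalPoly-⊙ (inv-suc k) ((0ℚ ∷ B) ⊕ ℚ.- K ⊙ B) x ⟩
  inv-suc k ℚ.* evalPoly ((0ℚ ∷ B) ⊕ ℚ.- K ⊙ B) x
    ≡⟨ cong (inv-suc k ℚ.*_) (trans (evalPoly-⊕ (0ℚ ∷ B) (ℚ.- K ⊙ B) x)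
         (cong ((0ℚ ℚ.+ x ℚ.* evalPoly B x) ℚ.+_) (evalPoly-⊙ (ℚ.- K) B x))) ⟩
  inv-suc k ℚ.* ((0ℚ ℚ.+ x ℚ.* evalPoly B x) ℚ.+ ℚ.- K ℚ.* evalPoly B x)
    ≡⟨ cong (λ y → inv-suc k ℚ.* ((0ℚ ℚ.+ x ℚ.* y) ℚ.+ ℚ.- K ℚ.* y)) (evalPoly-binomialPoly k n) ⟩
  inv-suc k ℚ.* ((0ℚ ℚ.+ x ℚ.* c) ℚ.+ ℚ.- K ℚ.* c)
    ≡⟨ cong (λ y → inv-suc k ℚ.* ((0ℚ ℚ.+ y) ℚ.+ ℚ.- K ℚ.* c)) absorptionℚ ⟨
  inv-suc k ℚ.* ((0ℚ ℚ.+ (K₁ ℚ.* c′ ℚ.+ K ℚ.* c)) ℚ.+ ℚ.- K ℚ.* c)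
    ≡⟨ solve 5 (λ r c c′ K K₁ → r :* ((con 0ℚ :+ (K₁ :* c′ :+ K :* c)) :+ :- K :* c)
                               := (r :* K₁) :* c′)
         refl (inv-suc k) c c′ K K₁ ⟩
  (inv-suc k ℚ.* K₁) ℚ.* c′
    ≡⟨ cong (ℚ._* c′) (inv-suc-* k) ⟩
  1ℚ ℚ.* c′
    ≡⟨ ℚP.*-identityˡ c′ ⟩
  c′ ∎
  where
  open ≡-Reasoning
  open +-*-Solver
  B = binomialPoly k
  x = ℕtoℚ n
  K = ℕtoℚ k
  K₁ = ℕtoℚ (suc k)
  c = ℕtoℚ (n C k)
  c′ = ℕtoℚ (n C suc k)
  absorptionℚ : K₁ ℚ.* c′ ℚ.+ K ℚ.* c ≡ x ℚ.* c
  absorptionℚ = begin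
    K₁ ℚ.* c′ ℚ.+ K ℚ.* c
      ≡⟨ cong₂ ℚ._+_ (ℕtoℚ-* (suc k) (n C suc k)) (ℕtoℚ-* k (n C k)) ⟨
    ℕtoℚ (suc k * (n C suc k)) ℚ.+ ℕtoℚ (k * (n C k))
      ≡⟨ ℕtoℚ-+ (suc k * (n C suc k)) (k * (n C k)) ⟨
    ℕtoℚ (suc k * (n C suc k) + k * (n C k))
      ≡⟨ cong ℕtoℚ (absorption n k) ⟩
    ℕtoℚ (n * (n C k))
      ≡⟨ ℕtoℚ-* n (n C k) ⟩
    x ℚ.* c ∎

binomialSumFrom : ℕ → List ℕ → ℕ → ℕ
binomialSumFrom k []       t = 0
binomialSumFrom k (d ∷ ds) t = d * (t C k) + binomialSumFrom (suc k) ds t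

binomialSum : List ℕ → ℕ → ℕ
binomialSum = binomialSumFrom 0

binomialSumFrom-suc : ∀ k ds t →
  binomialSumFrom (suc k) ds (suc t) ≡ binomialSumFrom k ds t + binomialSumFrom (suc k) ds t
binomialSumFrom-suc k []       t = refl
binomialSumFrom-suc k (d ∷ ds) t = begin
  d * (suc t C suc k) + binomialSumFrom (2 + k) ds (suc t)
    ≡⟨ cong₂ (λ c s → d * c + s) (sym (nCk+nC[k+1]≡[n+1]C[k+1] t k))
                                 (binomialSumFrom-suc (suc k) ds t) ⟩
  d * (t C k + t C suc k) + (binomialSumFrom (suc k) ds t + binomialSumFrom (2 + k) ds t)
    ≡⟨ distribute d (t C k) (t C suc k) _ _ ⟩
  (d * (t C k) + binomialSumFrom (suc k) ds t)
    + (d * (t C suc k) + binomialSumFrom (2 + k) ds t) ∎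
  where
  open ≡-Reasoning
  distribute : ∀ d a b x y → d * (a + b) + (x + y) ≡ (d * a + x) + (d * b + y)
  distribute = solve-∀

binomialSum-suc : ∀ d ds t → binomialSum (d ∷ ds) (suc t) ≡ binomialSum ds t + binomialSum (d ∷ ds) t
binomialSum-suc d ds t = begin
  d * 1 + binomialSumFrom 1 ds (suc t)
    ≡⟨ cong (d * 1 +_) (binomialSumFrom-suc 0 ds t) ⟩
  d * 1 + (binomialSum ds t + binomialSumFrom 1 ds t)
    ≡⟨ rearrange (d * 1) (binomialSum ds t) (binomialSumFrom 1 ds t) ⟩
  binomialSum ds t + (d * 1 + binomialSumFrom 1 ds t) ∎
  where
  open ≡-Reasoning
  rearrange : ∀ a b c → a + (b + c) ≡ b + (a + c)
  rearrange = solve-∀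

binomialSumFrom-suc-zero : ∀ k ds → binomialSumFrom (suc k) ds 0 ≡ 0
binomialSumFrom-suc-zero k []       = refl
binomialSumFrom-suc-zero k (d ∷ ds) = cong₂ _+_ (ℕP.*-zeroʳ d) (binomialSumFrom-suc-zero (suc k) ds)

binomialSum-zero : ∀ d ds → binomialSum (d ∷ ds) 0 ≡ d
binomialSum-zero d ds = trans (cong (d * 1 +_) (binomialSumFrom-suc-zero 0 ds))
                              (trans (ℕP.+-identityʳ (d * 1)) (ℕP.*-identityʳ d))

binomialPolyFrom : ℕ → List ℕ → List ℚ
binomialPolyFrom k []       = []
binomialPolyFrom k (d ∷ ds) = ℕtoℚ d ⊙ binomialPoly k ⊕ binomialPolyFrom (suc k) ds

evalPoly-binomialPolyFrom : ∀ k ds t →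
  evalPoly (binomialPolyFrom k ds) (ℕtoℚ t) ≡ ℕtoℚ (binomialSumFrom k ds t)
evalPoly-binomialPolyFrom k []       t = refl
evalPoly-binomialPolyFrom k (d ∷ ds) t = begin
  evalPoly (ℕtoℚ d ⊙ binomialPoly k ⊕ binomialPolyFrom (suc k) ds) x
    ≡⟨ evalPoly-⊕ (ℕtoℚ d ⊙ binomialPoly k) (binomialPolyFrom (suc k) ds) x ⟩
  evalPoly (ℕtoℚ d ⊙ binomialPoly k) x ℚ.+ evalPoly (binomialPolyFrom (suc k) ds) x
    ≡⟨ cong₂ ℚ._+_ (trans (evalPoly-⊙ (ℕtoℚ d) (binomialPoly k) x)
                          (cong (ℕtoℚ d ℚ.*_) (evalPoly-binomialPoly k t)))
                   (evalPoly-binomialPolyFrom (suc k) ds t) ⟩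
  ℕtoℚ d ℚ.* ℕtoℚ (t C k) ℚ.+ ℕtoℚ (binomialSumFrom (suc k) ds t)
    ≡⟨ cong (ℚ._+ ℕtoℚ (binomialSumFrom (suc k) ds t)) (ℕtoℚ-* d (t C k)) ⟨
  ℕtoℚ (d * (t C k)) ℚ.+ ℕtoℚ (binomialSumFrom (suc k) ds t)
    ≡⟨ ℕtoℚ-+ (d * (t C k)) (binomialSumFrom (suc k) ds t) ⟨
  ℕtoℚ (d * (t C k) + binomialSumFrom (suc k) ds t) ∎
  where
  open ≡-Reasoning
  x = ℕtoℚ t

binomialSum-polynomial : ∀ ds → ∃[ p ] ∀ t → ℕtoℚ (binomialSum ds t) ≡ evalPoly p (ℕtoℚ t)
binomialSum-polynomial ds = binomialPolyFrom 0 ds , λ t → sym (evalPoly-binomialPolyFrom 0 ds t)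

newton : (ℕ → ℕ) → ℕ → ℕ → ℕ
newton d j zero    = d j
newton d j (suc t) = newton d (suc j) t + newton d j t

segment : (ℕ → ℕ) → ℕ → ℕ → List ℕ
segment d j zero    = []
segment d j (suc r) = d j ∷ segment d (suc j) r

newton-binomialSum : ∀ t j r {d} → (∀ k → j + r ≤ k → d k ≡ 0) →
                     newton d j t ≡ binomialSum (segment d j r) t
newton-binomialSum zero    j zero    vanish = vanish j (ℕP.≤-reflexive (ℕP.+-identityʳ j))
newton-binomialSum zero    j (suc r) vanish = sym (binomialSum-zero _ (segment _ (suc j) r))
newton-binomialSum (suc t) j zero    vanish =
  cong₂ _+_ (newton-binomialSum t (suc j) 0 (λ k → vanish k ∘ ℕP.<⇒≤))
            (newton-binomialSum t j 0 vanish)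
newton-binomialSum (suc t) j (suc r) {d} vanish =
  trans (cong₂ _+_ (newton-binomialSum t (suc j) r (λ k → vanish k ∘ subst (_≤ k) (sym (ℕP.+-suc j r))))
                   (newton-binomialSum t j (suc r) vanish))
        (sym (binomialSum-suc (d j) (segment d (suc j) r) t))

module _ {A : Set} where

  HasCount-cong : {P Q : A → Set} {c : ℕ} → (∀ x → P x ⇔ Q x) → HasCount P c → HasCount Q c
  HasCount-cong P⇔Q (L , unique , mem , len) = L , unique , (λ x → P⇔Q x ⇔-∘ mem x) , len

  HasCount-filter : {P : A → Set} (P? : Decidable P) {xs : List A} →
                    Unique xs → (∀ x → x List.∈ xs) → HasCount P (length (filter P? xs))
  HasCount-filter P? {xs} unique complete =
    filter P? xs , UniqueP.filter⁺ P? unique ,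
    (λ x → mk⇔ (proj₂ ∘ ∈-filter⁻ P? {xs = xs}) (∈-filter⁺ P? (complete x))) , refl

  HasCount-split : {P S : A → Set} {a b : ℕ} → Decidable S →
                   HasCount (λ x → P x × S x) a → HasCount (λ x → P x × ¬ S x) b → HasCount P (a + b)
  HasCount-split {P} S? (L₁ , unique₁ , mem₁ , len₁) (L₂ , unique₂ , mem₂ , len₂) =
    L₁ ++ L₂ , UniqueP.++⁺ unique₁ unique₂ disjoint , (λ x → mk⇔ (to x) (from x)) ,
    trans (ListP.length-++ L₁) (cong₂ _+_ len₁ len₂)
    where
    disjoint : ∀ {x} → x List.∈ L₁ × x List.∈ L₂ → ⊥
    disjoint {x} (x∈L₁ , x∈L₂) =
      proj₂ (Equivalence.to (mem₂ x) x∈L₂) (proj₂ (Equivalence.to (mem₁ x) x∈L₁))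
    to : ∀ x → x List.∈ L₁ ++ L₂ → P x
    to x x∈ = [ proj₁ ∘ Equivalence.to (mem₁ x) , proj₁ ∘ Equivalence.to (mem₂ x) ]′ (∈-++⁻ L₁ x∈)
    from : ∀ x → P x → x List.∈ L₁ ++ L₂
    from x px with S? x
    ... | yes s  = ∈-++⁺ˡ (Equivalence.from (mem₁ x) (px , s))
    ... | no ¬s = ∈-++⁺ʳ L₁ (Equivalence.from (mem₂ x) (px , ¬s))

  HasCount-image : {B : Set} {P : A → Set} {Q : B → Set} {c : ℕ} (h : A → B) →
                   (∀ {x y} → h x ≡ h y → x ≡ y) → (∀ x → P x → Q (h x)) →
                   (∀ y → Q y → ∃[ x ] P x × h x ≡ y) → HasCount P c → HasCount Q c
  HasCount-image {Q = Q} h injective P⇒Q Q⇒P (L , unique , mem , len) =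
    List.map h L , UniqueP.map⁺ injective unique , (λ y → mk⇔ (to y) (from y)) ,
    trans (ListP.length-map h L) len
    where
    to : ∀ y → y List.∈ List.map h L → Q y
    to y y∈ with ∈-map⁻ h y∈
    ... | x , x∈L , refl = P⇒Q x (Equivalence.to (mem x) x∈L)
    from : ∀ y → Q y → y List.∈ List.map h L
    from y qy with Q⇒P y qy
    ... | x , px , refl = ∈-map⁺ h (Equivalence.from (mem x) px)

  HasCount-∅ : {P : A → Set} {c : ℕ} → (∀ x → ¬ P x) → HasCount P c → c ≡ 0
  HasCount-∅ ¬P ([]    , _ , _   , len) = sym len
  HasCount-∅ ¬P (x ∷ _ , _ , mem , _)   = ⊥-elim (¬P x (Equivalence.to (mem x) (here refl)))

allVecs : {A : Set} → List A → (m : ℕ) → List (Vec A m)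
allVecs xs zero    = [] ∷ []
allVecs xs (suc m) = cartesianProductWith _∷_ xs (allVecs xs m)

allVecs-unique : {A : Set} {xs : List A} → Unique xs → ∀ m → Unique (allVecs xs m)
allVecs-unique unique zero    = [] ∷ []
allVecs-unique unique (suc m) =
  UniqueP.cartesianProductWith⁺ _∷_ VecP.∷-injective unique (allVecs-unique unique m)

∈-allVecs : {A : Set} {xs : List A} → (∀ x → x List.∈ xs) →
            ∀ {m} (v : Vec A m) → v List.∈ allVecs xs m
∈-allVecs complete []       = here refl
∈-allVecs complete (x ∷ v) = ∈-cartesianProductWith⁺ _∷_ (complete x) (∈-allVecs complete v)

allLabels : (K : ℕ) → List (Label K)
allLabels K = cartesianProduct (allFin K) (bar ∷ pos ∷ [])

allLabels-unique : ∀ K → Unique (allLabels K)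
allLabels-unique K = UniqueP.cartesianProduct⁺ (UniqueP.allFin⁺ K) (((λ ()) ∷ []) ∷ [] ∷ [])

∈-allLabels : ∀ {K} (x : Label K) → x List.∈ allLabels K
∈-allLabels (k , bar) = ∈-cartesianProduct⁺ (∈-allFin k) (here refl)
∈-allLabels (k , pos) = ∈-cartesianProduct⁺ (∈-allFin k) (there (here refl))

LabelOrder : Sign → Sign → ℕ → ℕ → Set
LabelOrder pos bar k k′ = k < k′
LabelOrder _   _   k k′ = k ≤ k′

≤L⇔LabelOrder : ∀ {K} (k k′ : Fin K) s s′ → (k , s) ≤L (k′ , s′) ⇔ LabelOrder s s′ (toℕ k) (toℕ k′)
≤L⇔LabelOrder k k′ bar bar = mk⇔ (ℕP.*-cancelˡ-≤ 2) (ℕP.*-monoʳ-≤ 2)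
≤L⇔LabelOrder k k′ bar pos = mk⇔ from (ℕP.m≤n⇒m≤1+n ∘ ℕP.*-monoʳ-≤ 2)
  where
  from : 2 * toℕ k ≤ suc (2 * toℕ k′) → toℕ k ≤ toℕ k′
  from le = ℕ.s≤s⁻¹ (ℕP.*-cancelˡ-< 2 (toℕ k) (suc (toℕ k′))
                       (subst (2 * toℕ k <_) (sym (ℕP.*-suc 2 (toℕ k′))) (s≤s le)))
≤L⇔LabelOrder k k′ pos bar = mk⇔ (ℕP.*-cancelˡ-< 2 (toℕ k) (toℕ k′)) (ℕP.*-monoʳ-< 2)
≤L⇔LabelOrder k k′ pos pos = mk⇔ (ℕP.*-cancelˡ-≤ 2 ∘ ℕ.s≤s⁻¹) (s≤s ∘ ℕP.*-monoʳ-≤ 2)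

LabelOrder-cong : ∀ s s′ {a b c d} → (a ≤ b ⇔ c ≤ d) → (b ≤ a ⇔ d ≤ c) →
                  LabelOrder s s′ a b ⇔ LabelOrder s s′ c d
LabelOrder-cong bar bar a≤b⇔c≤d _ = a≤b⇔c≤d
LabelOrder-cong bar pos a≤b⇔c≤d _ = a≤b⇔c≤d
LabelOrder-cong pos pos a≤b⇔c≤d _ = a≤b⇔c≤d
LabelOrder-cong pos bar _ b≤a⇔d≤c =
  mk⇔ (λ a<b → ℕP.≰⇒> (ℕP.<⇒≱ a<b ∘ Equivalence.from b≤a⇔d≤c))
      (λ c<d → ℕP.≰⇒> (ℕP.<⇒≱ c<d ∘ Equivalence.to b≤a⇔d≤c))

≤L-map₁ : ∀ {K K′} {φ : Fin K → Fin K′} → (∀ k k′ → k Fin.≤ k′ ⇔ φ k Fin.≤ φ k′) →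
          ∀ x y → x ≤L y ⇔ map₁ φ x ≤L map₁ φ y
≤L-map₁ {φ = φ} embedding (k , s) (k′ , s′) =
  ⇔-sym (≤L⇔LabelOrder (φ k) (φ k′) s s′)
    ⇔-∘ (LabelOrder-cong s s′ (embedding k k′) (embedding k′ k) ⇔-∘ ≤L⇔LabelOrder k k′ s s′)

record SamePattern {m K K′} (f : Vec (Label K) m) (f′ : Vec (Label K′) m) : Set where
  field
    order : ∀ a b → lookup f a ≤L lookup f b ⇔ lookup f′ a ≤L lookup f′ b
    sign  : ∀ a → proj₂ (lookup f a) ≡ proj₂ (lookup f′ a)

open SamePattern

SamePattern-sym : ∀ {m K K′} {f : Vec (Label K) m} {f′ : Vec (Label K′) m} →
                  SamePattern f f′ → SamePattern f′ f
SamePattern-sym same .order a b = ⇔-sym (order same a b)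
SamePattern-sym same .sign a    = sym (sign same a)

relabel : ∀ {m K K′} → (Fin K → Fin K′) → Vec (Label K) m → Vec (Label K′) m
relabel φ = Vec.map (map₁ φ)

lookup-relabel : ∀ {m K K′} (φ : Fin K → Fin K′) (f : Vec (Label K) m) a →
                 lookup (relabel φ f) a ≡ map₁ φ (lookup f a)
lookup-relabel φ f a = VecP.lookup-map a (map₁ φ) f

relabel-SamePattern : ∀ {m K K′} {φ : Fin K → Fin K′} → (∀ k k′ → k Fin.≤ k′ ⇔ φ k Fin.≤ φ k′) →
                      (f : Vec (Label K) m) → SamePattern f (relabel φ f)
relabel-SamePattern {φ = φ} embedding f .order a b
  rewrite lookup-relabel φ f a | lookup-relabel φ f b = ≤L-map₁ embedding (lookup f a) (lookup f b)
relabel-SamePattern {φ = φ} embedding f .sign a = cong proj₂ (sym (lookup-relabel φ f a))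

relabel-injective : ∀ {m K K′} {φ : Fin K → Fin K′} → (∀ {k k′} → φ k ≡ φ k′ → k ≡ k′) →
                    ∀ {f f′ : Vec (Label K) m} → relabel φ f ≡ relabel φ f′ → f ≡ f′
relabel-injective {φ = φ} φ-injective {f} {f′} eq = Pointwise-≡⇒≡ (ext λ a → map₁-injective
  (trans (sym (lookup-relabel φ f a)) (trans (cong (λ v → lookup v a) eq) (lookup-relabel φ f′ a))))
  where
  map₁-injective : ∀ {x y : Label _} → map₁ φ x ≡ map₁ φ y → x ≡ y
  map₁-injective {_ , _} {_ , _} eq′ = cong₂ _,_ (φ-injective (cong proj₁ eq′)) (cong proj₂ eq′)

module _ {m : ℕ} (G : ConvexGeometry m) where
  open ConvexGeometry G
  open EnrichedExtremal

  isConvex? : ∀ A → Dec (IsConvex G A)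
  isConvex? A = VecP.≡-dec _≟ᵇ_ (g A) A

  _∈Ex?_ : ∀ a A → Dec (_∈Ex_ G a A)
  a ∈Ex? A = (a ∈? A) ×-dec isConvex? (A - a)

  allSubsets? : {Q : Subset m → Set} → (∀ A → Dec (Q A)) → Dec (∀ A → Q A)
  allSubsets? Q? with anySubset? (¬? ∘ Q?)
  ... | yes (A , ¬QA) = no (λ ∀Q → ¬QA (∀Q A))
  ... | no ¬∃¬Q       = yes (λ A → decidable-stable (Q? A) (λ ¬QA → ¬∃¬Q (A , ¬QA)))

  barred? : ∀ {K} (x : Label K) → Dec (Barred x)
  barred? (_ , bar) = yes refl
  barred? (_ , pos) = no (λ ())

  enrichedExtremal? : ∀ {K} (f : Vec (Label K) m) → Dec (EnrichedExtremal G f)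
  enrichedExtremal? f =
    map′ (λ (c₁ , c₂) → record { cond1 = c₁ ; cond2 = c₂ }) (λ ee → cond1 ee , cond2 ee)
    (allSubsets? (λ A → isConvex? A →-dec (FinP.any? (_∈? A) →-dec FinP.any? (λ a → (a ∈Ex? A) ×-dec
       FinP.all? (λ b → (b ∈? A) →-dec (code (lookup f a) ℕ.≤? code (lookup f b))))))
     ×-dec FinP.all? (λ a → barred? (lookup f a) →-dec (a ∈Ex? upSet G f a)))

  upSet-SamePattern : ∀ {K K′} {f : Vec (Label K) m} {f′ : Vec (Label K′) m} → SamePattern f f′ →
                      ∀ a → upSet G f a ≡ upSet G f′ a
  upSet-SamePattern {f = f} {f′} same a = VecP.tabulate-cong λ b →
    does-⇔ (order same a b) (code (lookup f a) ℕ.≤? code (lookup f b))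
                            (code (lookup f′ a) ℕ.≤? code (lookup f′ b))

  enrichedExtremal-SamePattern : ∀ {K K′} {f : Vec (Label K) m} {f′ : Vec (Label K′) m} →
                                 SamePattern f f′ → EnrichedExtremal G f → EnrichedExtremal G f′
  enrichedExtremal-SamePattern same ee .cond1 A convex nonempty with cond1 ee A convex nonempty
  ... | a , a∈Ex , minimal = a , a∈Ex , λ b b∈A → Equivalence.to (order same a b) (minimal b b∈A)
  enrichedExtremal-SamePattern same ee .cond2 a barred =
    subst (_∈Ex_ G a) (upSet-SamePattern same a) (cond2 ee a (trans (sign same a) barred))

toℕ-punchIn-< : ∀ {K} (i : Fin (suc K)) (k : Fin K) → toℕ k < toℕ i → toℕ (punchIn i k) ≡ toℕ k
toℕ-punchIn-< (Fin.suc i) Fin.zero    _   = refl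
toℕ-punchIn-< (Fin.suc i) (Fin.suc k) k<i = cong suc (toℕ-punchIn-< i k (ℕ.s≤s⁻¹ k<i))

module Levels {m : ℕ} (G : ConvexGeometry m) where

  Uses : ∀ {K} → Vec (Label K) m → Fin K → Set
  Uses f v = ∃[ a ] proj₁ (lookup f a) ≡ v

  uses? : ∀ {K} (f : Vec (Label K) m) v → Dec (Uses f v)
  uses? f v = FinP.any? (λ a → proj₁ (lookup f a) FinP.≟ v)

  Uses-relabel : ∀ {K K′} {φ : Fin K → Fin K′} → (∀ {k k′} → φ k ≡ φ k′ → k ≡ k′) →
                 (x : Vec (Label K) m) (v : Fin K) → Uses (relabel φ x) (φ v) ⇔ Uses x v
  Uses-relabel {φ = φ} φ-injective x v = mk⇔
    (λ (a , eq) → a , φ-injective (trans (sym (cong proj₁ (lookup-relabel φ x a))) eq))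
    (λ (a , eq) → a , trans (cong proj₁ (lookup-relabel φ x a)) (cong φ eq))

  usesAll⇒≤ : ∀ {K} (f : Vec (Label K) m) → (∀ v → Uses f v) → K ≤ m
  usesAll⇒≤ f uses = FinP.injective⇒≤ {f = proj₁ ∘ uses} λ {v} {v′} eq →
    trans (sym (proj₂ (uses v))) (trans (cong (λ a → proj₁ (lookup f a)) eq) (proj₂ (uses v′)))

  EnrichedExtremalUsing : ℕ → ∀ {K} → Vec (Label K) m → Set
  EnrichedExtremalUsing j f = EnrichedExtremal G f × (∀ v → toℕ v < j → Uses f v)

  enrichedExtremalUsing? : ∀ j {K} → Decidable (EnrichedExtremalUsing j {K})
  enrichedExtremalUsing? j f =
    enrichedExtremal? G f ×-dec FinP.all? (λ v → (toℕ v ℕ.<? j) →-dec uses? f v)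

  ontoCount : ℕ → ℕ
  ontoCount j = length (filter (enrichedExtremalUsing? j) (allVecs (allLabels j) m))

  ontoCount-HasCount : ∀ j → HasCount (EnrichedExtremalUsing j {j}) (ontoCount j)
  ontoCount-HasCount j =
    HasCount-filter (enrichedExtremalUsing? j) (allVecs-unique (allLabels-unique j) m)
                    (∈-allVecs ∈-allLabels)

  ontoCount-vanishes : ∀ j → m < j → ontoCount j ≡ 0
  ontoCount-vanishes j m<j = HasCount-∅
    (λ f (_ , uses) → ℕP.<⇒≱ m<j (usesAll⇒≤ f (λ v → uses v (FinP.toℕ<n v))))
    (ontoCount-HasCount j)

  module Recurrence {j K : ℕ} (j≤K : j ≤ K) where

    i : Fin (suc K)
    i = Fin.fromℕ< (s≤s j≤K)

    toℕ-i : toℕ i ≡ j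
    toℕ-i = FinP.toℕ-fromℕ< (s≤s j≤K)

    punchIn-embedding : ∀ k k′ → k Fin.≤ k′ ⇔ punchIn i k Fin.≤ punchIn i k′
    punchIn-embedding k k′ = mk⇔ (FinP.punchIn-mono-≤ i k k′) (FinP.punchIn-cancel-≤ i k k′)

    punchIn-injective : ∀ {k k′} → punchIn i k ≡ punchIn i k′ → k ≡ k′
    punchIn-injective {k} {k′} = FinP.punchIn-injective i k k′

    using-suc⇔ : ∀ f → EnrichedExtremalUsing (suc j) f ⇔ (EnrichedExtremalUsing j f × Uses f i)
    using-suc⇔ f = mk⇔
      (λ (ee , uses) → (ee , λ v v<j → uses v (ℕP.m≤n⇒m≤1+n v<j))
                       , uses i (s≤s (ℕP.≤-reflexive toℕ-i)))
      (λ ((ee , uses) , usesᵢ) → ee , λ v v<1+j →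
         [ uses v , (λ v≡j → subst (Uses f) (FinP.toℕ-injective (trans toℕ-i (sym v≡j))) usesᵢ) ]′
         (ℕP.m<1+n⇒m<n∨m≡n v<1+j))

    relabel-using⇔ : ∀ x → EnrichedExtremalUsing j {K} x
                         ⇔ EnrichedExtremalUsing j (relabel (punchIn i) x)
    relabel-using⇔ x = mk⇔
      (λ (ee , uses) → enrichedExtremal-SamePattern G same ee , usesBelow uses)
      (λ (ee , uses) → enrichedExtremal-SamePattern G (SamePattern-sym same) ee , usesBelow⁻ uses)
      where
      same : SamePattern x (relabel (punchIn i) x)
      same = relabel-SamePattern punchIn-embedding x
      below : ∀ k → toℕ k < j → toℕ (punchIn i k) ≡ toℕ k
      below k k<j = toℕ-punchIn-< i k (subst (toℕ k <_) (sym toℕ-i) k<j)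
      usesBelow : (∀ v → toℕ v < j → Uses x v) → ∀ v → toℕ v < j → Uses (relabel (punchIn i) x) v
      usesBelow uses v v<j =
        subst (Uses (relabel (punchIn i) x)) (FinP.toℕ-injective (trans (below k k<j) toℕ-k))
              (Equivalence.from (Uses-relabel punchIn-injective x k) (uses k k<j))
        where
        k : Fin K
        k = Fin.fromℕ< (ℕP.<-≤-trans v<j j≤K)
        toℕ-k : toℕ k ≡ toℕ v
        toℕ-k = FinP.toℕ-fromℕ< (ℕP.<-≤-trans v<j j≤K)
        k<j : toℕ k < j
        k<j = subst (_< j) (sym toℕ-k) v<j
      usesBelow⁻ : (∀ v → toℕ v < j → Uses (relabel (punchIn i) x) v) → ∀ v → toℕ v < j → Uses x v
      usesBelow⁻ uses v v<j = Equivalence.to (Uses-relabel punchIn-injective x v)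
                                (uses (punchIn i v) (subst (_< j) (sym (below v v<j)) v<j))

    relabel-unused : ∀ x → ¬ Uses (relabel (punchIn i) x) i
    relabel-unused x (a , eq) =
      FinP.punchInᵢ≢i i (proj₁ (lookup x a))
        (trans (sym (cong proj₁ (lookup-relabel (punchIn i) x a))) eq)

    unused-preimage : ∀ y → EnrichedExtremalUsing j y × ¬ Uses y i →
                      ∃[ x ] EnrichedExtremalUsing j {K} x × relabel (punchIn i) x ≡ y
    unused-preimage y (yUsing , unused) =
      x , Equivalence.from (relabel-using⇔ x) (subst (EnrichedExtremalUsing j) (sym relabel-x) yUsing)
        , relabel-x
      where
      x : Vec (Label K) m
      x = tabulate λ a → punchOut (λ i≡ → unused (a , sym i≡)) , proj₂ (lookup y a)
      relabel-x : relabel (punchIn i) x ≡ y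
      relabel-x = Pointwise-≡⇒≡ (ext λ a →
        trans (lookup-relabel (punchIn i) x a)
              (trans (cong (map₁ (punchIn i)) (VecP.lookup∘tabulate _ a))
                     (cong (_, proj₂ (lookup y a)) (FinP.punchIn-punchOut _))))

    HasCount-using-suc : ∀ {a b} → HasCount (EnrichedExtremalUsing (suc j) {suc K}) a →
                         HasCount (EnrichedExtremalUsing j {K}) b →
                         HasCount (EnrichedExtremalUsing j {suc K}) (a + b)
    HasCount-using-suc usingSuc usingBelow = HasCount-split (λ f → uses? f i)
      (HasCount-cong using-suc⇔ usingSuc)
      (HasCount-image (relabel (punchIn i)) (relabel-injective punchIn-injective)
        (λ x u → Equivalence.to (relabel-using⇔ x) u , relabel-unused x) unused-preimage usingBelow)

  HasCount-using : ∀ t j {K} → t + j ≡ K →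
                   HasCount (EnrichedExtremalUsing j {K}) (newton ontoCount j t)
  HasCount-using zero    j refl = ontoCount-HasCount j
  HasCount-using (suc t) j refl = Recurrence.HasCount-using-suc (ℕP.m≤n+m j t)
    (HasCount-using t (suc j) (ℕP.+-suc t j)) (HasCount-using t j refl)

mainTheorem7 : ∀ {m : ℕ} (G : ConvexGeometry m) →
    ∃[ p ] ∀ (n : ℕ) → ∃[ c ] (HasCount (EnrichedExtremal G {suc n}) c
                                × ℕtoℚ c ≡ evalPoly p (ℕtoℚ (suc n)))
mainTheorem7 {m} G = proj₁ polynomial , λ n → newton ontoCount 0 (suc n) , count n , value n
  where
  open Levels G
  polynomial : ∃[ p ] ∀ t → ℕtoℚ (binomialSum (segment ontoCount 0 (suc m)) t) ≡ evalPoly p (ℕtoℚ t)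
  polynomial = binomialSum-polynomial (segment ontoCount 0 (suc m))
  count : ∀ n → HasCount (EnrichedExtremal G {suc n}) (newton ontoCount 0 (suc n))
  count n = HasCount-cong (λ _ → mk⇔ proj₁ (λ ee → ee , λ _ ()))
                          (HasCount-using (suc n) 0 (ℕP.+-identityʳ (suc n)))
  value : ∀ n → ℕtoℚ (newton ontoCount 0 (suc n)) ≡ evalPoly (proj₁ polynomial) (ℕtoℚ (suc n))
  value n = trans (cong ℕtoℚ (newton-binomialSum (suc n) 0 (suc m) ontoCount-vanishes))
                  (proj₂ polynomial (suc n))
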